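{- Let $e\in\mathcal{PA}_n$ be a primitive ascent sequence with $\mathrm{asc}(e)=k$. Then $e$ avoids the vincular pattern $\underline{12}0$ if and only if its tail sequence $\mathbf{t}(e)$ is an inversion sequence of length $k+1$ that is non-decreasing.
   Context: An inversion sequence of length $n$ is an integer sequence $e=e_1\ldots e_n$ with $0\le e_i<i$ for all $i$. $\mathrm{asc}(e_1\ldots e_i)=|\{\ell\in[i-1]:e_\ell<e_{\ell+1}\}|$. An ascent sequence of length $n$ is an inversion sequence $e$ with $e_{i+1}\le \mathrm{asc}(e_1\ldots e_i)+1$ for $1\le i<n$; it is primitive if $e_i\ne e_{i+1}$ for all $i\in[n-1]$, and $\mathcal{PA}_n$ denotes the set of primitive ascent sequences of length $n$. For primitive $e$, partition $e$ uniquely into maximal (strictly) decreasing blocks of consecutive entries, called runs; the tail sequence $\mathbf{t}(e)$ is the sequence of the smallest (i.e. last) entries of the runs, in order (e.g. $e=0102324325=0/10/2/32/432/5$ has $\mathbf{t}(e)=002225$). A sequence $e$ avoids $\underline{12}0$ if there are no indices $2\le i<j\le n$ with $e_j<e_{i-1}<e_i$. -}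

module Defs where

open import Data.Nat using (ℕ; zero; suc; _+_; _<_; _≤_; _<ᵇ_)
open import Data.Bool using (if_then_else_)
open import Data.List using (List; []; _∷_; length; lookup; take; map)
open import Data.List.NonEmpty as L⁺ using (List⁺; _∷_; [_]; _∷⁺_)
open import Data.List.Relation.Unary.Linked using (Linked)
open import Data.Fin using (Fin; toℕ)
open import Data.Product using (_×_)
open import Relation.Binary.PropositionalEquality using (_≡_)
open import Relation.Nullary using (¬_)

-- Sequences are lists of naturals; positions are 0-indexed via Fin (length e),
-- so the paper's e_{i} is  lookup e i'  with  toℕ i' = i - 1.

IsInversionSeq : List ℕ → Set
IsInversionSeq e = (i : Fin (length e)) → lookup e i < suc (toℕ i)

asc : List ℕ → ℕ
asc [] = 0
asc (x ∷ []) = 0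
asc (x ∷ y ∷ ys) = (if x <ᵇ y then 1 else 0) + asc (y ∷ ys)

IsAscentSeq : List ℕ → Set
IsAscentSeq e = IsInversionSeq e ×
  ((i j : Fin (length e)) → toℕ j ≡ suc (toℕ i) →
     lookup e j ≤ asc (take (suc (toℕ i)) e) + 1)

IsPrimitive : List ℕ → Set
IsPrimitive e = (i j : Fin (length e)) → toℕ j ≡ suc (toℕ i) → ¬ (lookup e i ≡ lookup e j)

IsPrimAscentSeq : ℕ → List ℕ → Set
IsPrimAscentSeq n e = (length e ≡ n) × IsAscentSeq e × IsPrimitive e

-- decomposition of a nonempty sequence x ∷ xs into maximal strictly decreasing
-- runs of consecutive entries
runs⁺ : ℕ → List ℕ → List⁺ (List⁺ ℕ)
runs⁺ x [] = [ [ x ] ]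
runs⁺ x (y ∷ ys) with runs⁺ y ys
... | r ∷ rs = if y <ᵇ x then (x ∷⁺ r) ∷ rs else [ x ] ∷ (r ∷ rs)

runs : List ℕ → List (List⁺ ℕ)
runs [] = []
runs (x ∷ xs) = L⁺.toList (runs⁺ x xs)

tailSeq : List ℕ → List ℕ
tailSeq e = map L⁺.last (runs e)

-- e avoids the vincular pattern (12)0: no 2 ≤ i < j ≤ n with e_j < e_{i-1} < e_i
-- (here a = i-1, b = i, c = j in 0-indexed positions)
Avoids12-0 : List ℕ → Set
Avoids12-0 e = (a b c : Fin (length e)) → toℕ b ≡ suc (toℕ a) → toℕ b < toℕ c →
  ¬ ((lookup e c < lookup e a) × (lookup e a < lookup e b))

NonDecreasing : List ℕ → Set
NonDecreasing = Linked _≤_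

module Submission where

-- For a nonempty sequence x ∷ xs the tail sequence is computed by a one-pass
-- recursion `tails x xs`: if the next entry y is smaller than x, then x is not
-- the last entry of its run and is dropped; otherwise x closes its run.  For a
-- primitive sequence every non-descent is an ascent, which gives
--   * length (tails x xs) ≡ asc e + 1, one run boundary per ascent;
--   * e avoids (12)0  ⇔  after every ascent x < y all later entries are ≥ x
--                     ⇔  tails x xs is non-decreasing;
--   * the ascent condition bounds the i-th tail by the number of ascents
--     before it, which is at most i, so tails x xs is an inversion sequence.

open import Defs
open import Data.Nat using (ℕ; suc; _+_; _≤_; _<_; _<ᵇ_; z≤n; s≤s)
open import Data.Nat.Properties
  using (<ᵇ-reflects-<; <-asym; ≤-antisym; ≮⇒≥; <⇒≤; <⇒≱; ≤-trans
        ; suc-injective; +-suc; +-comm; +-identityʳ)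
open import Data.Bool using (Bool; true; false; if_then_else_)
open import Data.List using (List; []; _∷_; length; lookup; take; map; initLast; _∷ʳ′_)
open import Data.List.Properties using (tabulate-lookup)
import Data.List.NonEmpty as L⁺
open import Data.List.Relation.Unary.All as All using (All; []; _∷_)
open import Data.List.Relation.Unary.All.Properties using (tabulate⁺)
open import Data.List.Relation.Unary.AllPairs as AllPairs using ()
open import Data.List.Relation.Unary.Linked as Linked using (Linked; []; [-]; _∷_)
open import Data.List.Relation.Unary.Linked.Properties using (Linked⇒AllPairs)
open import Data.List.Relation.Binary.Sublist.Propositional using (_⊆_; []; _∷_; _∷ʳ_)
open import Data.List.Relation.Binary.Sublist.Propositional.Properties using (All-resp-⊆)
open import Data.List.Membership.Propositional.Properties using (∈-lookup)
open import Data.Fin using (Fin; toℕ) renaming (zero to fzero; suc to fsuc)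
open import Data.Product using (_×_; _,_)
open import Data.Unit using (⊤; tt)
open import Data.Empty using (⊥-elim)
open import Function.Bundles using (_⇔_; mk⇔)
open import Relation.Nullary.Reflects using (ofʸ; ofⁿ)
open import Relation.Binary.PropositionalEquality
  using (_≡_; _≢_; refl; sym; trans; cong; subst)

-- For distinct x and y exactly one of the tests  y <ᵇ x  (a descent, y
-- continues the run of x) and  x <ᵇ y  (an ascent) succeeds; matching on
-- this view evaluates both tests at once.
data Step (x y : ℕ) : Bool → Bool → Set where
  descent : y < x → Step x y true false
  ascent  : x < y → Step x y false true

step : ∀ {x y} → x ≢ y → Step x y (y <ᵇ x) (x <ᵇ y)
step {x} {y} x≢y
  with y <ᵇ x | <ᵇ-reflects-< y x | x <ᵇ y | <ᵇ-reflects-< x y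
... | true  | ofʸ y<x | true  | ofʸ x<y = ⊥-elim (<-asym x<y y<x)
... | true  | ofʸ y<x | false | _       = descent y<x
... | false | _       | true  | ofʸ x<y = ascent x<y
... | false | ofⁿ y≮x | false | ofⁿ x≮y = ⊥-elim (x≢y (≤-antisym (≮⇒≥ y≮x) (≮⇒≥ x≮y)))

All-tabulate : ∀ {P : ℕ → Set} xs → ((i : Fin (length xs)) → P (lookup xs i)) → All P xs
All-tabulate {P} xs f = subst (All P) (tabulate-lookup xs) (tabulate⁺ f)

primitive⇒linked : ∀ e → IsPrimitive e → Linked _≢_ e
primitive⇒linked []           _    = []
primitive⇒linked (x ∷ [])     _    = [-]
primitive⇒linked (x ∷ y ∷ ys) prim =
  prim fzero (fsuc fzero) refl
    ∷ primitive⇒linked (y ∷ ys) (λ i j j≡1+i → prim (fsuc i) (fsuc j) (cong suc j≡1+i))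

tails : ℕ → List ℕ → List ℕ
tails x []       = x ∷ []
tails x (y ∷ ys) = if y <ᵇ x then tails y ys else x ∷ tails y ys

last-∷⁺ : ∀ x (r : L⁺.List⁺ ℕ) → L⁺.last (x L⁺.∷⁺ r) ≡ L⁺.last r
last-∷⁺ x (y L⁺.∷ ys) with initLast ys
... | []      = refl
... | _ ∷ʳ′ _ = refl

tailSeq-tails : ∀ x xs → tailSeq (x ∷ xs) ≡ tails x xs
tailSeq-tails x []       = refl
tailSeq-tails x (y ∷ ys) with runs⁺ y ys | tailSeq-tails y ys
... | r L⁺.∷ rs | ih with y <ᵇ x
...   | true  = trans (cong (_∷ map L⁺.last rs) (last-∷⁺ x r)) ih
...   | false = cong (x ∷_) ih

-- Each run of a primitive sequence but the last ends at an ascent, so there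
-- is one tail per ascent plus the final one.
tails-length : ∀ x xs → Linked _≢_ (x ∷ xs) → length (tails x xs) ≡ suc (asc (x ∷ xs))
tails-length x []       _                = refl
tails-length x (y ∷ ys) (x≢y ∷ distinct) with y <ᵇ x | x <ᵇ y | step x≢y
... | _ | _ | descent _ = tails-length y ys distinct
... | _ | _ | ascent _  = cong suc (tails-length y ys distinct)

tails-⊆ : ∀ x xs → tails x xs ⊆ x ∷ xs
tails-⊆ x []       = refl ∷ []
tails-⊆ x (y ∷ ys) with y <ᵇ x
... | true  = x ∷ʳ tails-⊆ y ys
... | false = refl ∷ tails-⊆ y ys

-- Every entry is at least the tail of its run (runs decrease), so a lower
-- bound for the tails is a lower bound for the whole sequence.
tails-lowerBound : ∀ m x xs → All (m ≤_) (tails x xs) → All (m ≤_) (x ∷ xs)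
tails-lowerBound m x []       m≤tails = m≤tails
tails-lowerBound m x (y ∷ ys) m≤tails with y <ᵇ x | <ᵇ-reflects-< y x
... | true  | ofʸ y<x with tails-lowerBound m y ys m≤tails
...   | m≤y ∷ m≤ys = ≤-trans m≤y (<⇒≤ y<x) ∷ m≤y ∷ m≤ys
tails-lowerBound m x (y ∷ ys) (m≤x ∷ m≤tails) | false | _ =
  m≤x ∷ tails-lowerBound m y ys m≤tails

-- Avoiding (12)0 in adjacent form: after every ascent x < y, all later
-- entries are at least x.
AvoidsAdj : List ℕ → Set
AvoidsAdj (x ∷ y ∷ ys) = (x < y → All (x ≤_) ys) × AvoidsAdj (y ∷ ys)
AvoidsAdj _            = ⊤

avoids⇒adj : ∀ e → Avoids12-0 e → AvoidsAdj e
avoids⇒adj []           _  = tt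
avoids⇒adj (x ∷ [])     _  = tt
avoids⇒adj (x ∷ y ∷ ys) av = later , avoids⇒adj (y ∷ ys) shifted
  where
  later : x < y → All (x ≤_) ys
  later x<y = All-tabulate ys λ c →
    ≮⇒≥ λ c<x → av fzero (fsuc fzero) (fsuc (fsuc c)) refl (s≤s (s≤s z≤n)) (c<x , x<y)
  shifted : Avoids12-0 (y ∷ ys)
  shifted a b c b≡1+a b<c = av (fsuc a) (fsuc b) (fsuc c) (cong suc b≡1+a) (s≤s b<c)

-- An occurrence at positions a, a + 1, c either starts at the head (then it
-- violates the bound after the ascent x < y) or lies in the tail; the last
-- two clauses rule out positions with c ≤ a + 1.
adj⇒avoids : ∀ e → AvoidsAdj e → Avoids12-0 e
adj⇒avoids (x ∷ y ∷ ys) (later , _) fzero (fsuc fzero) (fsuc (fsuc c)) refl _ (c<x , x<y) =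
  <⇒≱ c<x (All.lookup (later x<y) (∈-lookup c))
adj⇒avoids (x ∷ y ∷ ys) (_ , rest) (fsuc a) (fsuc b) (fsuc c) b≡1+a (s≤s b<c) =
  adj⇒avoids (y ∷ ys) rest a b c (suc-injective b≡1+a) b<c
adj⇒avoids (x ∷ y ∷ ys) _ fzero (fsuc fzero) (fsuc fzero) refl (s≤s ())
adj⇒avoids (x ∷ y ∷ ys) _ (fsuc a) (fsuc b) fzero _ ()

nonDecreasing-head : ∀ {x L} → NonDecreasing (x ∷ L) → All (x ≤_) L
nonDecreasing-head nd = AllPairs.head (Linked⇒AllPairs ≤-trans nd)

nonDecreasing-∷ : ∀ {x L} → All (x ≤_) L → NonDecreasing L → NonDecreasing (x ∷ L)
nonDecreasing-∷ []        [] = [-]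
nonDecreasing-∷ (x≤t ∷ _) nd = x≤t ∷ nd

-- If the tails do not decrease, then an ascent x < y closes the run of x,
-- and every later entry is bounded below by a later tail, hence by x.
nonDecreasing⇒adj : ∀ x xs → NonDecreasing (tails x xs) → AvoidsAdj (x ∷ xs)
nonDecreasing⇒adj x []       _  = tt
nonDecreasing⇒adj x (y ∷ ys) nd with y <ᵇ x | <ᵇ-reflects-< y x
... | true  | ofʸ y<x = (λ x<y → ⊥-elim (<-asym x<y y<x)) , nonDecreasing⇒adj y ys nd
... | false | _       = later , nonDecreasing⇒adj y ys (Linked.tail nd)
  where
  later : x < y → All (x ≤_) ys
  later _ with tails-lowerBound x y ys (nonDecreasing-head nd)
  ... | _ ∷ x≤ys = x≤ys

-- Conversely, for a primitive sequence each retained x is followed by an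
-- ascent x < y, after which everything, in particular every later tail,
-- is at least x.
adj⇒nonDecreasing : ∀ x xs → Linked _≢_ (x ∷ xs) → AvoidsAdj (x ∷ xs) → NonDecreasing (tails x xs)
adj⇒nonDecreasing x []       _                _                = [-]
adj⇒nonDecreasing x (y ∷ ys) (x≢y ∷ distinct) (later , avoids) with y <ᵇ x | x <ᵇ y | step x≢y
... | _ | _ | descent _ = adj⇒nonDecreasing y ys distinct avoids
... | _ | _ | ascent x<y =
  nonDecreasing-∷ (All-resp-⊆ (tails-⊆ y ys) (<⇒≤ x<y ∷ later x<y))
                  (adj⇒nonDecreasing y ys distinct avoids)

-- The ascent condition with an offset d added to the ascent count; d = 0 is
-- the condition in `IsAscentSeq`.
AscentIdx : ℕ → List ℕ → Set
AscentIdx d e = (i j : Fin (length e)) → toℕ j ≡ suc (toℕ i) →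
  lookup e j ≤ d + asc (take (suc (toℕ i)) e) + 1

-- The ascent condition in adjacent form: c counts the ascents so far and p
-- is the previous entry; each next entry is at most c + 1.
AscentFrom : ℕ → ℕ → List ℕ → Set
AscentFrom c p []       = ⊤
AscentFrom c p (y ∷ ys) = y ≤ suc c × AscentFrom (if p <ᵇ y then suc c else c) y ys

offset-shift : ∀ b d a → d + ((if b then 1 else 0) + a) ≡ (if b then suc d else d) + a
offset-shift true  d a = +-suc d a
offset-shift false d a = refl

ascentIdx⇒from : ∀ d p ys → AscentIdx d (p ∷ ys) → AscentFrom d p ys
ascentIdx⇒from d p []       _          = tt
ascentIdx⇒from d p (y ∷ ys) ascentCond = first , ascentIdx⇒from _ y ys shifted
  where
  first : y ≤ suc d
  first = subst (y ≤_) (trans (cong (_+ 1) (+-identityʳ d)) (+-comm d 1))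
                (ascentCond fzero (fsuc fzero) refl)
  shifted : AscentIdx (if p <ᵇ y then suc d else d) (y ∷ ys)
  shifted i j j≡1+i = subst (λ t → lookup (y ∷ ys) j ≤ t + 1) (offset-shift (p <ᵇ y) d _)
                            (ascentCond (fsuc i) (fsuc j) (cong suc j≡1+i))

BoundedFrom : ℕ → List ℕ → Set
BoundedFrom m []       = ⊤
BoundedFrom m (z ∷ zs) = z ≤ m × BoundedFrom (suc m) zs

boundedFrom-lookup : ∀ m L → BoundedFrom m L → (i : Fin (length L)) → lookup L i ≤ m + toℕ i
boundedFrom-lookup m (z ∷ zs) (z≤m , _) fzero    = subst (z ≤_) (sym (+-identityʳ m)) z≤m
boundedFrom-lookup m (z ∷ zs) (_ , bs)  (fsuc i) =
  subst (lookup zs i ≤_) (sym (+-suc m (toℕ i))) (boundedFrom-lookup (suc m) zs bs i)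

-- A tail is bounded by the number c of ascents before it: within a run the
-- entries decrease, and each new run starts right after an ascent.
tails-bounded : ∀ c x xs → Linked _≢_ (x ∷ xs) → AscentFrom c x xs → x ≤ c →
  BoundedFrom c (tails x xs)
tails-bounded c x []       _                _              x≤c = x≤c , tt
tails-bounded c x (y ∷ ys) (x≢y ∷ distinct) (y≤1+c , ascs) x≤c with y <ᵇ x | x <ᵇ y | step x≢y
... | _ | _ | descent y<x = tails-bounded c y ys distinct ascs (≤-trans (<⇒≤ y<x) x≤c)
... | _ | _ | ascent _    = x≤c , tails-bounded (suc c) y ys distinct ascs y≤1+c

-- An ascent sequence x ∷ xs starts with x = 0, so its tails satisfy the
-- inversion bound.
tails-inversion : ∀ x xs → IsAscentSeq (x ∷ xs) → Linked _≢_ (x ∷ xs) →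
  IsInversionSeq (tails x xs)
tails-inversion x xs (inv , ascentCond) distinct i =
  s≤s (boundedFrom-lookup 0 (tails x xs) bounded i)
  where
  x≤0 : x ≤ 0
  x≤0 with inv fzero
  ... | s≤s x≤0 = x≤0
  bounded : BoundedFrom 0 (tails x xs)
  bounded = tails-bounded 0 x xs distinct (ascentIdx⇒from 0 x xs ascentCond) x≤0

TailCondition : ℕ → List ℕ → Set
TailCondition k t = IsInversionSeq t × length t ≡ suc k × NonDecreasing t

lemma2p1 : (n k : ℕ) → 1 ≤ n → (e : List ℕ) → IsPrimAscentSeq n e → asc e ≡ k →
    (Avoids12-0 e ⇔ (IsInversionSeq (tailSeq e) × length (tailSeq e) ≡ suc k × NonDecreasing (tailSeq e)))
lemma2p1 .0 _ () [] (refl , _)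
lemma2p1 _ _ _ (x ∷ xs) (_ , ascentSeq , prim) refl =
  subst (λ t → Avoids12-0 (x ∷ xs) ⇔ TailCondition (asc (x ∷ xs)) t) (sym (tailSeq-tails x xs))
    (mk⇔ (λ av → tails-inversion x xs ascentSeq distinct
               , tails-length x xs distinct
               , adj⇒nonDecreasing x xs distinct (avoids⇒adj (x ∷ xs) av))
         (λ (_ , _ , nd) → adj⇒avoids (x ∷ xs) (nonDecreasing⇒adj x xs nd)))
  where
  distinct : Linked _≢_ (x ∷ xs)
  distinct = primitive⇒linked (x ∷ xs) prim
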